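{- For the unary pattern $x^k$, we have $\lambda_\simeq(x^k)=3$ if $k\in\{2,3\}$, and $\lambda_\simeq(x^k)=2$ if $k\ge 4$.
   Context: A pattern is a word over an alphabet of variables; $x^k$ denotes the pattern consisting of the variable $x$ repeated $k$ times. For words, $x\simeq x'$ iff $x'\in\{x,x^R\}$ ($x^R$ the reversal). A word $w$ encounters a pattern $p=p_1\cdots p_n$ up to $\simeq$ if it has a factor $X_1\cdots X_n$ with all $X_i$ nonempty and $X_i\simeq X_j$ whenever $p_i=p_j$; otherwise it avoids $p$ up to $\simeq$. The undirected avoidability index $\lambda_\simeq(p)$ is the least positive integer $k$ such that some infinite word over a $k$-letter alphabet avoids $p$ up to $\simeq$, or $\infty$ if no such $k$ exists. -}

module Defs where

open import Data.Nat using (ℕ; _+_; _≤_; _<_)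
open import Data.Fin using (Fin)
open import Data.List using (List; []; _∷_; length; map; upTo; concat; reverse; zip; replicate)
open import Data.List.Membership.Propositional using (_∈_)
open import Data.List.Relation.Unary.All using (All)
open import Data.Product using (Σ; ∃; _×_; _,_)
open import Data.Sum using (_⊎_)
open import Relation.Nullary using (¬_)
open import Relation.Binary.PropositionalEquality using (_≡_; _≢_)

Word : Set → Set
Word A = List A

_≃_ : {A : Set} → Word A → Word A → Set
x ≃ x' = (x' ≡ x) ⊎ (x' ≡ reverse x)

InfWord : ℕ → Set
InfWord k = ℕ → Fin k

segment : {k : ℕ} → InfWord k → ℕ → ℕ → Word (Fin k)
segment w i n = map (λ j → w (i + j)) (upTo n)

IsFactor : {k : ℕ} → Word (Fin k) → InfWord k → Set
IsFactor u w = ∃ λ i → u ≡ segment w i (length u)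

Pattern : Set
Pattern = List ℕ

NonEmpty : {A : Set} → Word A → Set
NonEmpty u = u ≢ []

Encounters : {k : ℕ} → InfWord k → Pattern → Set
Encounters {k} w p =
  Σ (List (Word (Fin k))) λ Xs →
    (length Xs ≡ length p) ×
    All NonEmpty Xs ×
    (∀ {a b : ℕ} {X Y : Word (Fin k)} →
       (a , X) ∈ zip p Xs → (b , Y) ∈ zip p Xs → a ≡ b → X ≃ Y) ×
    IsFactor (concat Xs) w

Avoids : {k : ℕ} → InfWord k → Pattern → Set
Avoids w p = ¬ Encounters w p

AvoidableOver : Pattern → ℕ → Set
AvoidableOver p k = Σ (InfWord k) λ w → Avoids w p

UndirectedIndexIs : Pattern → ℕ → Set
UndirectedIndexIs p k =
  (1 ≤ k) × AvoidableOver p k × (∀ j → 1 ≤ j → j < k → ¬ AvoidableOver p j)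

xPow : ℕ → Pattern
xPow k = replicate k 0

-- Everything rests on the overlap-freeness of the Thue–Morse word t, t n = parity n + t ⌊n/2⌋
-- over ℤ/2.  An overlap of even period 2m at i halves to one of period m at ⌊i/2⌋.  Along an
-- overlap of odd period p, of any two positions at distance p one is even, and t changes after
-- every even position; so t changes after every position of [i, i + p), and t (i + p) ≠ t i.
--
-- The other facts reduce to this via the difference sequence Δ t, since f + g is constant
-- wherever Δ f and Δ g agree.  Along a square of period p in the ternary word t (x+1) − t x + 1,
-- the sum t (x + p) + t x is thus constant, and it is 0: at a change of t both letters determine
-- t x = t (x + p), and without changes t (i + p) = t i.  So t has an overlap; and as X Xᴿ
-- contains a square aa, this word avoids x^k up to ≃ for k ≥ 2.  In the period-doubling word
-- Δ t, a fourth power of period p makes t (x + p) + t x constant over three periods, giving an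
-- overlap of period p or 2p in t; a factor abba, whose symmetric pairs lie at odd distance,
-- forces Δ t = 1 at all four positions, i.e. the overlap ababa in t.  Without abba, X Xᴿ is a
-- factor only if |X| = 1, so a factor X₁X₂X₃X₄ with every Xᵢ ≃ X₁ is a fourth power.
--
-- For the lower bounds, a unary word encounters x^k, and an exhaustive search shows that every
-- binary word of length 4 (resp. 10) contains a square (resp. a cube) up to ≃.

module Submission where

open import Defs
open import Data.Nat using (ℕ; _≤_)
open import Data.Sum using (_⊎_)
open import Data.Product using (_×_)
open import Relation.Binary.PropositionalEquality using (_≡_)

open import Data.Nat using (zero; suc; _+_; _*_; _<_; _≤?_; z≤n; s≤s; ⌊_/2⌋; parity)
open import Data.Nat.Properties
  using ( +-suc; +-assoc; +-comm; +-identityʳ; +-mono-≤; +-monoʳ-≤; +-monoʳ-<; +-monoˡ-<; *-monoˡ-≤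
        ; m≤m+n; m≤n+m; m<m+n; ≤-trans; <-≤-trans; ≤-refl; ≤-pred; <⇒≤; n≤1+n; suc-injective
        ; ⌊n/2⌋<n; anyUpTo?; allUpTo?)
open import Data.Nat.Induction using (<-wellFounded; <-rec)
open import Data.Nat.Tactic.RingSolver using (solve-∀)
open import Data.Parity.Base using (Parity; 0ℙ; 1ℙ; _⁻¹) renaming (_+_ to _⊕_)
import Data.Parity.Properties as ℙ
open import Data.Fin using (Fin; zero; suc; toℕ; _≟_)
open import Data.Fin.Properties using (all?)
open import Data.Vec as Vec using (Vec; tabulate)
open import Data.List using (List; []; _∷_; _++_; length; applyUpTo; concat; reverse; zip)
open import Data.List.Properties
  using ( ∷-injective; ∷-injectiveˡ; ∷-injectiveʳ; ++-assoc; length-++; length-applyUpTo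
        ; length-replicate; length-map; length-upTo; map-upTo; reverse-++; reverse-involutive; ≡-dec)
open import Data.List.Membership.Propositional using (_∈_)
open import Data.List.Membership.Propositional.Properties using (∈-applyUpTo⁻)
open import Data.List.Relation.Unary.Any using (here; there)
open import Data.List.Relation.Unary.All using (_∷_)
open import Data.List.Relation.Unary.All.Properties using (applyUpTo⁺₁)
open import Data.Product using (∃; _,_; proj₁; proj₂; map₁; map₂)
open import Data.Sum using (inj₁; inj₂; [_,_]′)
import Data.Sum as Sum
open import Data.Empty using (⊥; ⊥-elim)
open import Function using (_∘_; id)
open import Induction.WellFounded using (WfRec; module FixPoint)
open import Relation.Nullary using (¬_; Dec; contradiction)
open import Relation.Nullary.Decidable using (_×-dec_; _⊎-dec_; map′; from-yes)
open import Relation.Unary using (Decidable)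
open import Relation.Binary.PropositionalEquality
  using (_≢_; refl; sym; trans; cong; cong₂; subst; subst₂; module ≡-Reasoning)

open ≡-Reasoning

-- Lists and factors of infinite words

module _ {A : Set} where

  applyUpTo-cong : ∀ {f g : ℕ → A} n → (∀ t → t < n → f t ≡ g t) → applyUpTo f n ≡ applyUpTo g n
  applyUpTo-cong zero    _  = refl
  applyUpTo-cong (suc n) eq =
    cong₂ _∷_ (eq 0 (s≤s z≤n)) (applyUpTo-cong n λ t t<n → eq (suc t) (s≤s t<n))

  applyUpTo-≡⇒agree : ∀ {f g : ℕ → A} n → applyUpTo f n ≡ applyUpTo g n →
                      ∀ t → t < n → f t ≡ g t
  applyUpTo-≡⇒agree (suc n) eq zero    _         = ∷-injectiveˡ eq
  applyUpTo-≡⇒agree (suc n) eq (suc t) (s≤s t<n) = applyUpTo-≡⇒agree n (∷-injectiveʳ eq) t t<n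

  applyUpTo-++ : ∀ (f : ℕ → A) m n →
                 applyUpTo f (m + n) ≡ applyUpTo f m ++ applyUpTo (λ t → f (m + t)) n
  applyUpTo-++ f zero    n = refl
  applyUpTo-++ f (suc m) n = cong (f 0 ∷_) (applyUpTo-++ (f ∘ suc) m n)

  ++-injective : ∀ {xs ys xs′ ys′ : List A} →
                 length xs ≡ length ys → xs ++ xs′ ≡ ys ++ ys′ → xs ≡ ys × xs′ ≡ ys′
  ++-injective {[]}     {[]}     _   eq = refl , eq
  ++-injective {x ∷ xs} {y ∷ ys} len eq with ∷-injective eq
  ... | refl , eq′ = map₁ (cong (x ∷_)) (++-injective (suc-injective len) eq′)

  NonEmpty⇒1≤length : ∀ {X : List A} → NonEmpty X → 1 ≤ length X
  NonEmpty⇒1≤length {[]}    X≢[] = ⊥-elim (X≢[] refl)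
  NonEmpty⇒1≤length {_ ∷ _} _    = s≤s z≤n

  reverse≡[] : ∀ {xs : List A} → reverse xs ≡ [] → xs ≡ []
  reverse≡[] {xs} eq = trans (sym (reverse-involutive xs)) (cong reverse eq)

  abba-positions : ∀ {a b x₀ x₁ x₂ x₃ : A} →
                   _≡_ {A = List A} (a ∷ b ∷ b ∷ a ∷ []) (x₀ ∷ x₁ ∷ x₂ ∷ x₃ ∷ []) →
                   x₀ ≡ x₃ × x₁ ≡ x₂
  abba-positions refl = refl , refl

  ∈-zip⁻ʳ : ∀ {B : Set} {b : B} {x : A} bs xs → (b , x) ∈ zip bs xs → x ∈ xs
  ∈-zip⁻ʳ (_ ∷ _)  (_ ∷ _)  (here refl) = here refl
  ∈-zip⁻ʳ (_ ∷ bs) (_ ∷ xs) (there p)   = there (∈-zip⁻ʳ bs xs p)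

  ≃-euclidean : ∀ {X Y Z : List A} → X ≃ Y → X ≃ Z → Y ≃ Z
  ≃-euclidean         (inj₁ refl) (inj₁ refl) = inj₁ refl
  ≃-euclidean         (inj₁ refl) (inj₂ refl) = inj₂ refl
  ≃-euclidean {X = X} (inj₂ refl) (inj₁ refl) = inj₂ (sym (reverse-involutive X))
  ≃-euclidean         (inj₂ refl) (inj₂ refl) = inj₁ refl

-- The factor of length p + L at position i has period p: L = p is a square, L = suc p an overlap.
Periodic : {A : Set} → (ℕ → A) → ℕ → ℕ → ℕ → Set
Periodic w i p L = ∀ t → t < L → w (i + p + t) ≡ w (i + t)

Periodic-injective : ∀ {A B : Set} {g : A → B} {w : ℕ → A} {i p L} →
                     (∀ {x y} → g x ≡ g y → x ≡ y) → Periodic (g ∘ w) i p L → Periodic w i p L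
Periodic-injective g-injective periodic t t<L = g-injective (periodic t t<L)

module _ {k : ℕ} where

  length-segment : ∀ (w : InfWord k) i n → length (segment w i n) ≡ n
  length-segment w i n = trans (length-map _ (applyUpTo id n)) (length-upTo n)

  segment-++ : ∀ (w : InfWord k) i m n → segment w i (m + n) ≡ segment w i m ++ segment w (i + m) n
  segment-++ w i m n = begin
    segment w i (m + n)
      ≡⟨ map-upTo _ (m + n) ⟩
    applyUpTo (λ j → w (i + j)) (m + n)
      ≡⟨ applyUpTo-++ _ m n ⟩
    applyUpTo (λ j → w (i + j)) m ++ applyUpTo (λ t → w (i + (m + t))) n
      ≡⟨ cong₂ _++_ (sym (map-upTo _ m))
                    (trans (applyUpTo-cong n λ t _ → cong w (sym (+-assoc i m t))) (sym (map-upTo _ n))) ⟩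
    segment w i m ++ segment w (i + m) n
      ∎

  segment-cong : ∀ (w w′ : InfWord k) i n → (∀ t → t < n → w (i + t) ≡ w′ (i + t)) →
                 segment w i n ≡ segment w′ i n
  segment-cong w w′ i n agree =
    trans (map-upTo _ n) (trans (applyUpTo-cong n agree) (sym (map-upTo _ n)))

  segment-≡⇒Periodic : ∀ (w : InfWord k) i p L → segment w (i + p) L ≡ segment w i L → Periodic w i p L
  segment-≡⇒Periodic w i p L eq =
    applyUpTo-≡⇒agree L (trans (sym (map-upTo _ L)) (trans eq (map-upTo _ L)))

  segment-split : ∀ (w : InfWord k) i u v → u ++ v ≡ segment w i (length (u ++ v)) →
                  u ≡ segment w i (length u) × v ≡ segment w (i + length u) (length v)
  segment-split w i u v eq = ++-injective (sym (length-segment w i (length u))) (begin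
    u ++ v                                                          ≡⟨ eq ⟩
    segment w i (length (u ++ v))                                   ≡⟨ cong (segment w i) (length-++ u) ⟩
    segment w i (length u + length v)                               ≡⟨ segment-++ w i (length u) (length v) ⟩
    segment w i (length u) ++ segment w (i + length u) (length v)   ∎)

  module _ {w : InfWord k} where

    segment-IsFactor : ∀ i n → IsFactor (segment w i n) w
    segment-IsFactor i n = i , cong (segment w i) (sym (length-segment w i n))

    IsFactor-prefix : ∀ {u v} → IsFactor (u ++ v) w → IsFactor u w
    IsFactor-prefix {u} {v} (i , eq) = i , proj₁ (segment-split w i u v eq)

    IsFactor-suffix : ∀ {u v} → IsFactor (u ++ v) w → IsFactor v w
    IsFactor-suffix {u} {v} (i , eq) = i + length u , proj₂ (segment-split w i u v eq)

    IsFactor-pair : ∀ {u v r} → IsFactor (u ++ v ++ r) w → IsFactor (u ++ v) w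
    IsFactor-pair {u} {v} {r} fac =
      IsFactor-prefix (subst (λ x → IsFactor x w) (sym (++-assoc u v r)) fac)

    IsFactor⇒Periodic : ∀ X Y Z → X ++ Y ≡ Y ++ Z → IsFactor (X ++ Y) w →
                        ∃ λ i → Periodic w i (length X) (length Y)
    IsFactor⇒Periodic X Y Z shift (i , eq) =
      i , segment-≡⇒Periodic w i (length X) (length Y) (trans (sym shifted) unshifted)
      where
      shifted : Y ≡ segment w (i + length X) (length Y)
      shifted = proj₂ (segment-split w i X Y eq)
      unshifted : Y ≡ segment w i (length Y)
      unshifted = proj₁ (segment-split w i Y Z (subst (λ u → u ≡ segment w i (length u)) shift eq))

    IsFactor-square⇒Periodic : ∀ X → IsFactor (X ++ X) w → ∃ λ i → Periodic w i (length X) (length X)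
    IsFactor-square⇒Periodic X = IsFactor⇒Periodic X X X refl

    IsFactor-fourthPower⇒Periodic : ∀ X → IsFactor (X ++ X ++ X ++ X) w →
                                    ∃ λ i → Periodic w i (length X) (length X + (length X + length X))
    IsFactor-fourthPower⇒Periodic X fac =
      map₂ (subst (Periodic w _ (length X)) (trans (length-++ X) (cong (length X +_) (length-++ X))))
           (IsFactor⇒Periodic X (X ++ X ++ X) X shift fac)
      where
      shift : X ++ X ++ X ++ X ≡ (X ++ X ++ X) ++ X
      shift = sym (trans (++-assoc X (X ++ X) X) (cong (X ++_) (++-assoc X X X)))

    IsFactor-mirror : ∀ {X} c Z → reverse X ≡ c ++ Z → IsFactor (X ++ c ++ Z) w →
                      IsFactor (reverse c ++ c) w
    IsFactor-mirror {X} c Z mirror fac =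
      IsFactor-prefix {v = Z} (IsFactor-suffix {u = reverse Z} (subst (λ u → IsFactor u w) rearranged fac))
      where
      X≡ : X ≡ reverse Z ++ reverse c
      X≡ = begin
        X                       ≡⟨ sym (reverse-involutive X) ⟩
        reverse (reverse X)     ≡⟨ cong reverse mirror ⟩
        reverse (c ++ Z)        ≡⟨ reverse-++ c Z ⟩
        reverse Z ++ reverse c  ∎
      rearranged : X ++ c ++ Z ≡ reverse Z ++ (reverse c ++ c) ++ Z
      rearranged = begin
        X ++ c ++ Z                           ≡⟨ cong (_++ c ++ Z) X≡ ⟩
        (reverse Z ++ reverse c) ++ c ++ Z    ≡⟨ ++-assoc (reverse Z) (reverse c) (c ++ Z) ⟩
        reverse Z ++ reverse c ++ c ++ Z      ≡⟨ cong (reverse Z ++_) (sym (++-assoc (reverse c) c Z)) ⟩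
        reverse Z ++ (reverse c ++ c) ++ Z    ∎

    IsFactor-mirror⇒square : ∀ {X} → NonEmpty X → IsFactor (X ++ reverse X) w →
                             ∃ λ a → IsFactor (a ∷ a ∷ []) w
    IsFactor-mirror⇒square {X} X≢[] fac with reverse X in mirror
    ... | []    = ⊥-elim (X≢[] (reverse≡[] mirror))
    ... | a ∷ Z = a , IsFactor-mirror (a ∷ []) Z mirror fac

    squareFree⇒avoids : (∀ X → NonEmpty X → ¬ IsFactor (X ++ X) w) → ∀ K → Avoids w (xPow (2 + K))
    squareFree⇒avoids squareFree K (X ∷ X₁ ∷ _ , _ , X≢[] ∷ _ , related , fac)
      with related (here refl) (there (here refl)) refl
    ... | inj₁ refl = squareFree X X≢[] (IsFactor-pair {X} {X} fac)
    ... | inj₂ refl with a , aa ← IsFactor-mirror⇒square X≢[] (IsFactor-pair {X} {reverse X} fac) =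
      squareFree (a ∷ []) (λ ()) aa

    module _ (abbaFree : ∀ a b → ¬ IsFactor (a ∷ b ∷ b ∷ a ∷ []) w) where

      abbaFree⇒mirror-palindromic : ∀ {X} → IsFactor (X ++ reverse X) w → reverse X ≡ X
      abbaFree⇒mirror-palindromic {X} fac with reverse X in mirror
      ... | []        = sym (reverse≡[] mirror)
      ... | a ∷ []    = sym (trans (sym (reverse-involutive X)) (cong reverse mirror))
      ... | b ∷ a ∷ Z = ⊥-elim (abbaFree a b (IsFactor-mirror (b ∷ a ∷ []) Z mirror fac))

      abbaFree⇒adjacent-≃⇒≡ : ∀ {X Y} → IsFactor (X ++ Y) w → X ≃ Y → Y ≡ X
      abbaFree⇒adjacent-≃⇒≡ _   (inj₁ eq)   = eq
      abbaFree⇒adjacent-≃⇒≡ fac (inj₂ refl) = abbaFree⇒mirror-palindromic fac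

      abbaFree∧fourthPowerFree⇒avoids : (∀ X → NonEmpty X → ¬ IsFactor (X ++ X ++ X ++ X) w) →
                                        ∀ K → Avoids w (xPow (4 + K))
      abbaFree∧fourthPowerFree⇒avoids fourthPowerFree K
        (X ∷ X₁ ∷ X₂ ∷ X₃ ∷ R , _ , X≢[] ∷ _ , related , fac)
        with abbaFree⇒adjacent-≃⇒≡ (IsFactor-pair {X} {X₁} fac)
                                   (related (here refl) (there (here refl)) refl)
      ... | refl with abbaFree⇒adjacent-≃⇒≡ (IsFactor-pair {X} {X₂} (IsFactor-suffix {X} fac))
                                           (related (here refl) (there (there (here refl))) refl)
      ... | refl with abbaFree⇒adjacent-≃⇒≡
                        (IsFactor-pair {X} {X₃} (IsFactor-suffix {X} (IsFactor-suffix {X} fac)))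
                        (related (here refl) (there (there (there (here refl)))) refl)
      ... | refl =
        fourthPowerFree X X≢[] (IsFactor-prefix {v = concat R} (subst (λ u → IsFactor u w) regroup fac))
        where
        regroup : X ++ X ++ X ++ X ++ concat R ≡ (X ++ X ++ X ++ X) ++ concat R
        regroup = sym (begin
          (X ++ X ++ X ++ X) ++ concat R   ≡⟨ ++-assoc X (X ++ X ++ X) (concat R) ⟩
          X ++ (X ++ X ++ X) ++ concat R   ≡⟨ cong (X ++_) (++-assoc X (X ++ X) (concat R)) ⟩
          X ++ X ++ (X ++ X) ++ concat R   ≡⟨ cong (λ u → X ++ X ++ u) (++-assoc X X (concat R)) ⟩
          X ++ X ++ X ++ X ++ concat R     ∎)

-- Sequences over ℤ/2

0ℙ⊎1ℙ : ∀ p → p ≡ 0ℙ ⊎ p ≡ 1ℙ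
0ℙ⊎1ℙ 0ℙ = inj₁ refl
0ℙ⊎1ℙ 1ℙ = inj₂ refl

0ℙ≢1ℙ : 0ℙ ≢ 1ℙ
0ℙ≢1ℙ ()

⊕-moveʳ : ∀ x y {z} → x ⊕ y ≡ z → x ≡ z ⊕ y
⊕-moveʳ x y refl = sym (begin
  (x ⊕ y) ⊕ y   ≡⟨ ℙ.+-assoc x y y ⟩
  x ⊕ (y ⊕ y)   ≡⟨ cong (x ⊕_) (ℙ.p+p≡0ℙ y) ⟩
  x ⊕ 0ℙ        ≡⟨ ℙ.+-identityʳ x ⟩
  x             ∎)

≡⇒⊕≡0ℙ : ∀ {x y} → x ≡ y → x ⊕ y ≡ 0ℙ
≡⇒⊕≡0ℙ {y = y} refl = ℙ.p+p≡0ℙ y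

⊕-interchange : ∀ x x′ y y′ → x ⊕ x′ ≡ y ⊕ y′ → x′ ⊕ y′ ≡ x ⊕ y
⊕-interchange 0ℙ x′ 0ℙ y′ refl = ℙ.p+p≡0ℙ x′
⊕-interchange 0ℙ x′ 1ℙ y′ refl = ℙ.p⁻¹+p≡1ℙ y′
⊕-interchange 1ℙ x′ 0ℙ y′ refl = ℙ.p+p⁻¹≡1ℙ x′
⊕-interchange 1ℙ x′ 1ℙ y′ eq rewrite ℙ.⁻¹-injective eq = ℙ.p+p≡0ℙ y′

parity-+-double : ∀ i q → parity (i + (q + q)) ≡ parity i
parity-+-double i q = begin
  parity (i + (q + q))        ≡⟨ ℙ.+-homo-+ i (q + q) ⟩
  parity i ⊕ parity (q + q)   ≡⟨ cong (parity i ⊕_) (trans (ℙ.+-homo-+ q q) (ℙ.p+p≡0ℙ (parity q))) ⟩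
  parity i ⊕ 0ℙ               ≡⟨ ℙ.+-identityʳ (parity i) ⟩
  parity i                    ∎

parity-+-odd : ∀ {n} → parity n ≡ 1ℙ → ∀ x → parity (x + n) ≡ parity x ⁻¹
parity-+-odd {n} odd x = begin
  parity (x + n)        ≡⟨ ℙ.+-homo-+ x n ⟩
  parity x ⊕ parity n   ≡⟨ cong (parity x ⊕_) odd ⟩
  parity x ⊕ 1ℙ         ≡⟨ ℙ.+-comm (parity x) 1ℙ ⟩
  parity x ⁻¹           ∎

even-or-even-+-odd : ∀ {n} → parity n ≡ 1ℙ → ∀ x → parity x ≡ 0ℙ ⊎ parity (x + n) ≡ 0ℙ
even-or-even-+-odd odd x =
  Sum.map₂ (λ x-odd → trans (parity-+-odd odd x) (cong _⁻¹ x-odd)) (0ℙ⊎1ℙ (parity x))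

even⇒double : ∀ {n} → parity n ≡ 0ℙ → ∃ λ q → n ≡ q + q
even⇒double {zero}        _    = 0 , refl
even⇒double {suc (suc n)} even with q , refl ← even⇒double {n} even = suc q , cong suc (sym (+-suc q q))

⌊+double/2⌋ : ∀ i q → ⌊ i + (q + q) /2⌋ ≡ ⌊ i /2⌋ + q
⌊+double/2⌋ i zero    = trans (cong ⌊_/2⌋ (+-identityʳ i)) (sym (+-identityʳ _))
⌊+double/2⌋ i (suc q) = begin
  ⌊ i + (suc q + suc q) /2⌋   ≡⟨ cong ⌊_/2⌋ (two-more i q) ⟩
  suc ⌊ i + (q + q) /2⌋       ≡⟨ cong suc (⌊+double/2⌋ i q) ⟩
  suc (⌊ i /2⌋ + q)           ≡⟨ sym (+-suc ⌊ i /2⌋ q) ⟩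
  ⌊ i /2⌋ + suc q             ∎
  where
  two-more : ∀ i q → i + (suc q + suc q) ≡ suc (suc (i + (q + q)))
  two-more = solve-∀

Δ : (ℕ → Parity) → ℕ → Parity
Δ f x = f x ⊕ f (suc x)

Δ-agree⇒difference-constant : ∀ (f g : ℕ → Parity) a b L →
                              (∀ t → t < L → Δ f (a + t) ≡ Δ g (b + t)) →
                              ∀ s → s ≤ L → f (a + s) ⊕ g (b + s) ≡ f a ⊕ g b
Δ-agree⇒difference-constant f g a b L agree zero _ =
  cong₂ (λ x y → f x ⊕ g y) (+-identityʳ a) (+-identityʳ b)
Δ-agree⇒difference-constant f g a b L agree (suc s) s<L = begin
  f (a + suc s) ⊕ g (b + suc s)       ≡⟨ cong₂ (λ x y → f x ⊕ g y) (+-suc a s) (+-suc b s) ⟩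
  f (suc (a + s)) ⊕ g (suc (b + s))   ≡⟨ ⊕-interchange (f (a + s)) _ (g (b + s)) _ (agree s s<L) ⟩
  f (a + s) ⊕ g (b + s)               ≡⟨ Δ-agree⇒difference-constant f g a b L agree s (<⇒≤ s<L) ⟩
  f a ⊕ g b                           ∎

Δ-parity : ∀ t → Δ parity t ≡ 1ℙ
Δ-parity zero          = refl
Δ-parity (suc zero)    = refl
Δ-parity (suc (suc t)) = Δ-parity t

Δ≡1ℙ⇒alternating : ∀ f a L → (∀ t → t < L → Δ f (a + t) ≡ 1ℙ) →
                   ∀ s → s ≤ L → f (a + s) ⊕ parity s ≡ f a
Δ≡1ℙ⇒alternating f a L jumps s s≤L = trans
  (Δ-agree⇒difference-constant f parity a 0 L (λ t t<L → trans (jumps t t<L) (sym (Δ-parity t))) s s≤L)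
  (ℙ.+-identityʳ (f a))

Δ≡0ℙ⇒constant : ∀ f a L → (∀ t → t < L → Δ f (a + t) ≡ 0ℙ) → f (a + L) ≡ f a
Δ≡0ℙ⇒constant f a L flat =
  ℙ.+-cancelʳ-≡ 0ℙ _ _ (Δ-agree⇒difference-constant f (λ _ → 0ℙ) a 0 L flat L ≤-refl)

Periodic-Δ : ∀ f i p L → Periodic f i p (suc L) → Periodic (Δ f) i p L
Periodic-Δ f i p L periodic t t<L = cong₂ _⊕_
  (periodic t (<⇒≤ (s≤s t<L)))
  (trans (cong f (sym (+-suc (i + p) t))) (trans (periodic (suc t) (s≤s t<L)) (cong f (+-suc i t))))

Periodic-Δ⇒difference-constant : ∀ f i p L → Periodic (Δ f) i p L →
                                 ∀ s → s ≤ L → f (i + p + s) ⊕ f (i + s) ≡ f (i + p) ⊕ f i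
Periodic-Δ⇒difference-constant f i p L = Δ-agree⇒difference-constant f f (i + p) i L

-- The Thue–Morse word

thueMorseStep : ∀ n → WfRec _<_ (λ _ → Parity) n → Parity
thueMorseStep zero    _   = 0ℙ
thueMorseStep (suc n) rec = parity (suc n) ⊕ rec (⌊n/2⌋<n n)

thueMorseStep-cong : ∀ n {rec rec′ : WfRec _<_ (λ _ → Parity) n} →
                     (∀ {m} (m<n : m < n) → rec m<n ≡ rec′ m<n) →
                     thueMorseStep n rec ≡ thueMorseStep n rec′
thueMorseStep-cong zero    _  = refl
thueMorseStep-cong (suc n) eq = cong (parity (suc n) ⊕_) (eq (⌊n/2⌋<n n))

-- Opaque so that unification never unfolds the well-founded recursion.
opaque
  thueMorse : ℕ → Parity
  thueMorse = <-rec _ thueMorseStep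

  thueMorse-unfold : ∀ n → thueMorse n ≡ parity n ⊕ thueMorse ⌊ n /2⌋
  thueMorse-unfold zero    = refl
  thueMorse-unfold (suc n) = unfold-wfRec {suc n}
    where
    open FixPoint <-wellFounded (λ _ → Parity) thueMorseStep thueMorseStep-cong

thueMorse-+-double : ∀ i q → thueMorse (i + (q + q)) ≡ parity i ⊕ thueMorse (⌊ i /2⌋ + q)
thueMorse-+-double i q = begin
  thueMorse (i + (q + q))
    ≡⟨ thueMorse-unfold (i + (q + q)) ⟩
  parity (i + (q + q)) ⊕ thueMorse ⌊ i + (q + q) /2⌋
    ≡⟨ cong₂ _⊕_ (parity-+-double i q) (cong thueMorse (⌊+double/2⌋ i q)) ⟩
  parity i ⊕ thueMorse (⌊ i /2⌋ + q)
    ∎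

Δ-thueMorse-even : ∀ x → parity x ≡ 0ℙ → Δ thueMorse x ≡ 1ℙ
Δ-thueMorse-even x even with q , refl ← even⇒double {x} even =
  trans (cong₂ _⊕_ (thueMorse-+-double 0 q) (thueMorse-+-double 1 q)) (ℙ.p+p⁻¹≡1ℙ (thueMorse q))

Δ-thueMorse-odd-distance : ∀ {n} → parity n ≡ 1ℙ → ∀ x →
                           Δ thueMorse x ≡ 1ℙ ⊎ Δ thueMorse (x + n) ≡ 1ℙ
Δ-thueMorse-odd-distance odd x =
  Sum.map (Δ-thueMorse-even x) (Δ-thueMorse-even (x + _)) (even-or-even-+-odd odd x)

thueMorse-noOddOverlap : ∀ i p → parity p ≡ 1ℙ → ¬ Periodic thueMorse i p (suc p)
thueMorse-noOddOverlap i p odd periodic = ℙ.p≢p⁻¹ (thueMorse i) (begin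
  thueMorse i                    ≡⟨ sym (Δ≡1ℙ⇒alternating thueMorse i p jumps p ≤-refl) ⟩
  thueMorse (i + p) ⊕ parity p   ≡⟨ cong₂ _⊕_ periodic-start odd ⟩
  thueMorse i ⊕ 1ℙ               ≡⟨ ℙ.+-comm (thueMorse i) 1ℙ ⟩
  thueMorse i ⁻¹                 ∎)
  where
  periodic-start : thueMorse (i + p) ≡ thueMorse i
  periodic-start = begin
    thueMorse (i + p)       ≡⟨ cong thueMorse (sym (+-identityʳ (i + p))) ⟩
    thueMorse (i + p + 0)   ≡⟨ periodic 0 (s≤s z≤n) ⟩
    thueMorse (i + 0)       ≡⟨ cong thueMorse (+-identityʳ i) ⟩
    thueMorse i             ∎
  jumps : ∀ t → t < p → Δ thueMorse (i + t) ≡ 1ℙ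
  jumps t t<p = [ id , (λ shifted → trans (sym (Periodic-Δ thueMorse i p p periodic t t<p))
                                          (trans (cong (Δ thueMorse) (swap i p t)) shifted)) ]′
                (Δ-thueMorse-odd-distance odd (i + t))
    where
    swap : ∀ i p t → i + p + t ≡ i + t + p
    swap = solve-∀

Periodic-thueMorse-half : ∀ i m → Periodic thueMorse i (m + m) (suc (m + m)) →
                          Periodic thueMorse ⌊ i /2⌋ m (suc m)
Periodic-thueMorse-half i m periodic t t≤m = ℙ.+-cancelˡ-≡ (parity i) _ _ (begin
  parity i ⊕ thueMorse (⌊ i /2⌋ + m + t)     ≡⟨ cong ((parity i ⊕_) ∘ thueMorse) (+-assoc ⌊ i /2⌋ m t) ⟩
  parity i ⊕ thueMorse (⌊ i /2⌋ + (m + t))   ≡⟨ sym (thueMorse-+-double i (m + t)) ⟩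
  thueMorse (i + ((m + t) + (m + t)))         ≡⟨ cong thueMorse (regroup i m t) ⟩
  thueMorse (i + (m + m) + (t + t))           ≡⟨ periodic (t + t) (s≤s (+-mono-≤ t≤m′ t≤m′)) ⟩
  thueMorse (i + (t + t))                     ≡⟨ thueMorse-+-double i t ⟩
  parity i ⊕ thueMorse (⌊ i /2⌋ + t)         ∎)
  where
  t≤m′ = ≤-pred t≤m
  regroup : ∀ i m t → i + ((m + t) + (m + t)) ≡ i + (m + m) + (t + t)
  regroup = solve-∀

thueMorse-overlapFree : ∀ p i → 1 ≤ p → ¬ Periodic thueMorse i p (suc p)
thueMorse-overlapFree = <-rec _ overlapFree
  where
  overlapFree : ∀ p → (∀ {q} → q < p → ∀ i → 1 ≤ q → ¬ Periodic thueMorse i q (suc q)) →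
                ∀ i → 1 ≤ p → ¬ Periodic thueMorse i p (suc p)
  overlapFree p shorter i 1≤p periodic with 0ℙ⊎1ℙ (parity p)
  ... | inj₂ odd = thueMorse-noOddOverlap i p odd periodic
  ... | inj₁ even with even⇒double {p} even
  ...   | zero  , refl = contradiction 1≤p λ ()
  ...   | suc m , refl =
    shorter (m<m+n (suc m) (s≤s z≤n)) ⌊ i /2⌋ (s≤s z≤n) (Periodic-thueMorse-half i (suc m) periodic)

-- The ternary word

-- differenceLetter a b is b − a + 1.
differenceLetter : Parity → Parity → Fin 3
differenceLetter 1ℙ 0ℙ = zero
differenceLetter 0ℙ 0ℙ = suc zero
differenceLetter 1ℙ 1ℙ = suc zero
differenceLetter 0ℙ 1ℙ = suc (suc zero)

isJump : Fin 3 → Parity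
isJump (suc zero) = 0ℙ
isJump _          = 1ℙ

isJump-differenceLetter : ∀ a b → isJump (differenceLetter a b) ≡ a ⊕ b
isJump-differenceLetter 0ℙ 0ℙ = refl
isJump-differenceLetter 0ℙ 1ℙ = refl
isJump-differenceLetter 1ℙ 0ℙ = refl
isJump-differenceLetter 1ℙ 1ℙ = refl

jumpSource : Fin 3 → Parity
jumpSource zero = 1ℙ
jumpSource _    = 0ℙ

jumpSource-differenceLetter : ∀ a b → a ⊕ b ≡ 1ℙ → jumpSource (differenceLetter a b) ≡ a
jumpSource-differenceLetter 0ℙ 1ℙ _ = refl
jumpSource-differenceLetter 1ℙ 0ℙ _ = refl

ternaryThueMorse : InfWord 3
ternaryThueMorse x = differenceLetter (thueMorse x) (thueMorse (suc x))

ternaryThueMorse-squareFree : ∀ i p → 1 ≤ p → ¬ Periodic ternaryThueMorse i p p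
ternaryThueMorse-squareFree i p 1≤p square = thueMorse-overlapFree p i 1≤p periodic
  where
  jumps-periodic : Periodic (Δ thueMorse) i p p
  jumps-periodic t t<p = begin
    Δ thueMorse (i + p + t)                 ≡⟨ sym (isJump-differenceLetter _ _) ⟩
    isJump (ternaryThueMorse (i + p + t))   ≡⟨ cong isJump (square t t<p) ⟩
    isJump (ternaryThueMorse (i + t))       ≡⟨ isJump-differenceLetter _ _ ⟩
    Δ thueMorse (i + t)                     ∎

  difference : ∀ s → s ≤ p → thueMorse (i + p + s) ⊕ thueMorse (i + s) ≡ thueMorse (i + p) ⊕ thueMorse i
  difference = Periodic-Δ⇒difference-constant thueMorse i p p jumps-periodic

  agree-at-jump : ∀ t → t < p → Δ thueMorse (i + t) ≡ 1ℙ → thueMorse (i + p + t) ≡ thueMorse (i + t)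
  agree-at-jump t t<p jump = begin
    thueMorse (i + p + t)
      ≡⟨ sym (jumpSource-differenceLetter _ _ (trans (jumps-periodic t t<p) jump)) ⟩
    jumpSource (ternaryThueMorse (i + p + t))
      ≡⟨ cong jumpSource (square t t<p) ⟩
    jumpSource (ternaryThueMorse (i + t))
      ≡⟨ jumpSource-differenceLetter _ _ jump ⟩
    thueMorse (i + t)
      ∎

  difference≢1ℙ : thueMorse (i + p) ⊕ thueMorse i ≢ 1ℙ
  difference≢1ℙ difference≡1ℙ =
    0ℙ≢1ℙ (trans (sym (≡⇒⊕≡0ℙ (Δ≡0ℙ⇒constant thueMorse i p no-jump))) difference≡1ℙ)
    where
    no-jump : ∀ t → t < p → Δ thueMorse (i + t) ≡ 0ℙ
    no-jump t t<p = [ id , (λ jump → ⊥-elim (0ℙ≢1ℙ (begin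
      0ℙ                                         ≡⟨ sym (≡⇒⊕≡0ℙ (agree-at-jump t t<p jump)) ⟩
      thueMorse (i + p + t) ⊕ thueMorse (i + t)  ≡⟨ difference t (<⇒≤ t<p) ⟩
      thueMorse (i + p) ⊕ thueMorse i            ≡⟨ difference≡1ℙ ⟩
      1ℙ                                         ∎))) ]′ (0ℙ⊎1ℙ _)

  periodic : Periodic thueMorse i p (suc p)
  periodic t t≤p =
    ⊕-moveʳ _ _ (trans (difference t (≤-pred t≤p)) ([ id , ⊥-elim ∘ difference≢1ℙ ]′ (0ℙ⊎1ℙ _)))

ternaryThueMorse-avoids : ∀ K → Avoids ternaryThueMorse (xPow (2 + K))
ternaryThueMorse-avoids = squareFree⇒avoids {w = ternaryThueMorse} λ X X≢[] square →
  let i , periodic = IsFactor-square⇒Periodic {w = ternaryThueMorse} X square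
  in ternaryThueMorse-squareFree i (length X) (NonEmpty⇒1≤length X≢[]) periodic

-- The period-doubling word

periodDoubling : ℕ → Parity
periodDoubling = Δ thueMorse

periodDoubling-fourthPowerFree : ∀ i p → 1 ≤ p → ¬ Periodic periodDoubling i p (p + (p + p))
periodDoubling-fourthPowerFree i p 1≤p fourthPower =
  [ thueMorse-overlapFree p i 1≤p ∘ periodic
  , thueMorse-overlapFree (p + p) i (≤-trans 1≤p (m≤m+n p p)) ∘ antiperiodic
  ]′ (0ℙ⊎1ℙ (thueMorse (i + p) ⊕ thueMorse i))
  where
  difference : ∀ s → s ≤ p + (p + p) →
               thueMorse (i + p + s) ⊕ thueMorse (i + s) ≡ thueMorse (i + p) ⊕ thueMorse i
  difference = Periodic-Δ⇒difference-constant thueMorse i p (p + (p + p)) fourthPower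

  periodic : thueMorse (i + p) ⊕ thueMorse i ≡ 0ℙ → Periodic thueMorse i p (suc p)
  periodic d≡0ℙ t t≤p = ⊕-moveʳ _ _ (trans (difference t (≤-trans (≤-pred t≤p) (m≤m+n p _))) d≡0ℙ)

  antiperiodic : thueMorse (i + p) ⊕ thueMorse i ≡ 1ℙ → Periodic thueMorse i (p + p) (suc (p + p))
  antiperiodic d≡1ℙ t t≤2p = begin
    thueMorse (i + (p + p) + t)   ≡⟨ cong thueMorse (regroup i p t) ⟩
    thueMorse (i + p + (p + t))   ≡⟨ flip (p + t) (+-monoʳ-≤ p (≤-pred t≤2p)) ⟩
    thueMorse (i + (p + t)) ⁻¹    ≡⟨ cong (λ x → thueMorse x ⁻¹) (sym (+-assoc i p t)) ⟩
    thueMorse (i + p + t) ⁻¹      ≡⟨ cong _⁻¹ (flip t (≤-trans (≤-pred t≤2p) (m≤n+m (p + p) p))) ⟩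
    thueMorse (i + t) ⁻¹ ⁻¹       ≡⟨ ℙ.⁻¹-involutive (thueMorse (i + t)) ⟩
    thueMorse (i + t)             ∎
    where
    flip : ∀ s → s ≤ p + (p + p) → thueMorse (i + p + s) ≡ thueMorse (i + s) ⁻¹
    flip s s≤ = ⊕-moveʳ _ _ (trans (difference s s≤) d≡1ℙ)
    regroup : ∀ i p t → i + (p + p) + t ≡ i + p + (p + t)
    regroup = solve-∀

periodDoubling-odd-distance : ∀ {n} → parity n ≡ 1ℙ → ∀ x →
                              periodDoubling x ≡ periodDoubling (x + n) →
                              periodDoubling x ≡ 1ℙ × periodDoubling (x + n) ≡ 1ℙ
periodDoubling-odd-distance odd x eq =
  [ (λ jump → jump , trans (sym eq) jump) , (λ jump → trans eq jump , jump) ]′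
  (Δ-thueMorse-odd-distance odd x)

periodDoubling-abbaFree : ∀ i → periodDoubling (i + 0) ≡ periodDoubling (i + 3) →
                          periodDoubling (i + 1) ≡ periodDoubling (i + 2) → ⊥
periodDoubling-abbaFree i outer inner = thueMorse-overlapFree 2 i (s≤s z≤n) period-2
  where
  i+0+3 : periodDoubling (i + 3) ≡ periodDoubling (i + 0 + 3)
  i+0+3 = cong periodDoubling (sym (+-assoc i 0 3))
  i+1+1 : periodDoubling (i + 2) ≡ periodDoubling (i + 1 + 1)
  i+1+1 = cong periodDoubling (sym (+-assoc i 1 1))
  outer-jumps = periodDoubling-odd-distance {3} refl (i + 0) (trans outer i+0+3)
  inner-jumps = periodDoubling-odd-distance {1} refl (i + 1) (trans inner i+1+1)

  jumps : ∀ t → t < 4 → Δ thueMorse (i + t) ≡ 1ℙ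
  jumps 0 _ = proj₁ outer-jumps
  jumps 1 _ = proj₁ inner-jumps
  jumps 2 _ = trans i+1+1 (proj₂ inner-jumps)
  jumps 3 _ = trans i+0+3 (proj₂ outer-jumps)
  jumps (suc (suc (suc (suc _)))) (s≤s (s≤s (s≤s (s≤s ()))))

  alternating = Δ≡1ℙ⇒alternating thueMorse i 4 jumps

  period-2 : Periodic thueMorse i 2 3
  period-2 t t<3 = ℙ.+-cancelʳ-≡ (parity t) _ _ (begin
    thueMorse (i + 2 + t) ⊕ parity t     ≡⟨ cong (λ x → thueMorse x ⊕ parity t) (+-assoc i 2 t) ⟩
    thueMorse (i + (2 + t)) ⊕ parity t   ≡⟨ alternating (2 + t) (s≤s (s≤s (≤-pred t<3))) ⟩
    thueMorse i                          ≡⟨ sym (alternating t (≤-trans (<⇒≤ t<3) (n≤1+n 3))) ⟩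
    thueMorse (i + t) ⊕ parity t         ∎)

parityToFin : Parity → Fin 2
parityToFin 0ℙ = zero
parityToFin 1ℙ = suc zero

parityToFin-injective : ∀ {p q} → parityToFin p ≡ parityToFin q → p ≡ q
parityToFin-injective {0ℙ} {0ℙ} _ = refl
parityToFin-injective {1ℙ} {1ℙ} _ = refl

periodDoublingWord : InfWord 2
periodDoublingWord = parityToFin ∘ periodDoubling

periodDoublingWord-avoids : ∀ K → Avoids periodDoublingWord (xPow (4 + K))
periodDoublingWord-avoids =
  abbaFree∧fourthPowerFree⇒avoids {w = periodDoublingWord} abbaFree fourthPowerFree
  where
  fourthPowerFree : ∀ X → NonEmpty X → ¬ IsFactor (X ++ X ++ X ++ X) periodDoublingWord
  fourthPowerFree X X≢[] fourthPower =
    let i , periodic = IsFactor-fourthPower⇒Periodic {w = periodDoublingWord} X fourthPower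
    in periodDoubling-fourthPowerFree i (length X) (NonEmpty⇒1≤length X≢[])
         (Periodic-injective {w = periodDoubling} {i} {length X} parityToFin-injective periodic)
  abbaFree : ∀ a b → ¬ IsFactor (a ∷ b ∷ b ∷ a ∷ []) periodDoublingWord
  abbaFree a b (i , abba) =
    let outer , inner = abba-positions abba
    in periodDoubling-abbaFree i (parityToFin-injective outer) (parityToFin-injective inner)

-- Unavoidability over one and two letters

module _ {k : ℕ} where

  blocks : InfWord k → ℕ → ℕ → ℕ → List (Word (Fin k))
  blocks w i n K = applyUpTo (λ j → segment w (j * n + i) n) K

  Power≃ : InfWord k → ℕ → ℕ → ℕ → Set
  Power≃ w i n K = ∀ {j} → j < K → segment w i n ≃ segment w (j * n + i) n

  _≃?_ : (X Y : Word (Fin k)) → Dec (X ≃ Y)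
  X ≃? Y = ≡-dec _≟_ Y X ⊎-dec ≡-dec _≟_ Y (reverse X)

  Power≃? : ∀ w i n K → Dec (Power≃ w i n K)
  Power≃? w i n = allUpTo? (λ j → segment w i n ≃? segment w (j * n + i) n)

  concat-blocks : ∀ (w : InfWord k) i n K → concat (blocks w i n K) ≡ segment w i (K * n)
  concat-blocks w i n zero    = refl
  concat-blocks w i n (suc K) = begin
    segment w i n ++ concat (applyUpTo (λ j → segment w (n + j * n + i) n) K)
      ≡⟨ cong (λ Xs → segment w i n ++ concat Xs)
              (applyUpTo-cong K λ j _ → cong (λ x → segment w x n) (regroup n j i)) ⟩
    segment w i n ++ concat (blocks w (i + n) n K)
      ≡⟨ cong (segment w i n ++_) (concat-blocks w (i + n) n K) ⟩
    segment w i n ++ segment w (i + n) (K * n)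
      ≡⟨ sym (segment-++ w i n (K * n)) ⟩
    segment w i (n + K * n)
      ∎
    where
    regroup : ∀ n j i → n + j * n + i ≡ j * n + (i + n)
    regroup = solve-∀

  Power≃⇒Encounters : ∀ {w : InfWord k} {i n} K → 1 ≤ n → Power≃ w i n K → Encounters w (xPow K)
  Power≃⇒Encounters {w} {i} {suc n} K _ power =
    blocks w i (suc n) K ,
    trans (length-applyUpTo _ K) (sym (length-replicate K)) ,
    applyUpTo⁺₁ _ K (λ _ ()) ,
    (λ X∈ Y∈ _ → ≃-euclidean (block-≃ (∈-zip⁻ʳ _ _ X∈)) (block-≃ (∈-zip⁻ʳ _ _ Y∈))) ,
    subst (λ u → IsFactor u w) (sym (concat-blocks w i (suc n) K)) (segment-IsFactor {w = w} i (K * suc n))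
    where
    block-≃ : ∀ {X} → X ∈ blocks w i (suc n) K → segment w i (suc n) ≃ X
    block-≃ X∈ with j , j<K , refl ← ∈-applyUpTo⁻ _ X∈ = power j<K

  block-bound : ∀ {i j n t K} → j < K → t < n → j * n + i + t < K * n + i
  block-bound {i} {j} {n} {t} {K} j<K t<n =
    subst (_< K * n + i) (swap (j * n) t i)
      (+-monoˡ-< i (<-≤-trans (+-monoʳ-< (j * n) t<n)
                              (subst (_≤ K * n) (+-comm n (j * n)) (*-monoˡ-≤ n j<K))))
    where
    swap : ∀ a b c → a + b + c ≡ a + c + b
    swap = solve-∀

  Power≃-transfer : ∀ {w w′ : InfWord k} {i n K} → (∀ x → x < K * n + i → w′ x ≡ w x) →
                    Power≃ w′ i n K → Power≃ w i n K
  Power≃-transfer {w} {w′} {i} {n} {K} agree power j<K =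
    subst₂ _≃_ (block (≤-trans (s≤s z≤n) j<K)) (block j<K) (power j<K)
    where
    block : ∀ {j} → j < K → segment w′ (j * n + i) n ≡ segment w (j * n + i) n
    block j<K = segment-cong w′ w _ n λ t t<n → agree _ (block-bound j<K t<n)

unary-encounters : ∀ K (w : InfWord 1) → Encounters w (xPow K)
unary-encounters K w =
  Power≃⇒Encounters {w = w} {0} {1} K (s≤s z≤n) λ _ → inj₁ (cong (_∷ []) (Fin1-unique _ _))
  where
  Fin1-unique : (a b : Fin 1) → a ≡ b
  Fin1-unique zero zero = refl

extend : ∀ {N} → Vec (Fin 2) N → InfWord 2
extend Vec.[]      _       = zero
extend (x Vec.∷ v) zero    = x
extend (x Vec.∷ v) (suc j) = extend v j

extend-tabulate : ∀ N (w : InfWord 2) x → x < N → extend (tabulate {n = N} (w ∘ toℕ)) x ≡ w x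
extend-tabulate (suc N) w zero    _         = refl
extend-tabulate (suc N) w (suc x) (s≤s x<N) = extend-tabulate N (w ∘ suc) x x<N

allVecs? : ∀ {k} N {P : Vec (Fin k) N → Set} → Decidable P → Dec (∀ v → P v)
allVecs? zero    P? = map′ (λ { p Vec.[] → p }) (λ f → f Vec.[]) (P? Vec.[])
allVecs? (suc N) P? = map′ (λ { f (x Vec.∷ v) → f x v }) (λ f x v → f (x Vec.∷ v))
                           (all? λ x → allVecs? N λ v → P? (x Vec.∷ v))

PowerBelow : ℕ → ℕ → InfWord 2 → Set
PowerBelow K N w = ∃ λ i → i < N × ∃ λ n → n < N × 1 ≤ n × K * n + i ≤ N × Power≃ w i n K

PowerBelow? : ∀ K N w → Dec (PowerBelow K N w)
PowerBelow? K N w = anyUpTo? (λ i → anyUpTo? (λ n →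
  (1 ≤? n) ×-dec ((K * n + i ≤? N) ×-dec Power≃? w i n K)) N) N

encounters-from-prefixes : ∀ K N → (∀ v → PowerBelow K N (extend v)) →
                           ∀ (w : InfWord 2) → Encounters w (xPow K)
encounters-from-prefixes K N search w
  with i , _ , n , _ , 1≤n , bound , power ← search (tabulate {n = N} (w ∘ toℕ)) =
  Power≃⇒Encounters {w = w} K 1≤n
    (Power≃-transfer {w = w} {extend (tabulate {n = N} (w ∘ toℕ))}
                     (λ x x< → extend-tabulate N w x (<-≤-trans x< bound)) power)

-- 4 and 10 are the least prefix lengths for which these searches succeed.
binary-encounters-xPow2 : ∀ (w : InfWord 2) → Encounters w (xPow 2)
binary-encounters-xPow2 =
  encounters-from-prefixes 2 4 (from-yes (allVecs? 4 λ v → PowerBelow? 2 4 (extend v)))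

binary-encounters-xPow3 : ∀ (w : InfWord 2) → Encounters w (xPow 3)
binary-encounters-xPow3 =
  encounters-from-prefixes 3 10 (from-yes (allVecs? 10 λ v → PowerBelow? 3 10 (extend v)))

unavoidable : ∀ {p j} → (∀ (w : InfWord j) → Encounters w p) → ¬ AvoidableOver p j
unavoidable encounters (w , avoids) = avoids (encounters w)

xPow-index≡2 : ∀ k (w : InfWord 2) → Avoids w (xPow k) → UndirectedIndexIs (xPow k) 2
xPow-index≡2 k w avoids = s≤s z≤n , (w , avoids) , below
  where
  below : ∀ j → 1 ≤ j → j < 2 → ¬ AvoidableOver (xPow k) j
  below 1 _ _ = unavoidable (unary-encounters k)
  below (suc (suc _)) _ (s≤s (s≤s ()))

xPow-index≡3 : ∀ k (w : InfWord 3) → Avoids w (xPow k) → (∀ (w : InfWord 2) → Encounters w (xPow k)) →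
               UndirectedIndexIs (xPow k) 3
xPow-index≡3 k w avoids binary = s≤s z≤n , (w , avoids) , below
  where
  below : ∀ j → 1 ≤ j → j < 3 → ¬ AvoidableOver (xPow k) j
  below 1 _ _ = unavoidable (unary-encounters k)
  below 2 _ _ = unavoidable binary
  below (suc (suc (suc _))) _ (s≤s (s≤s (s≤s ())))

theorem7 : ((k : ℕ) → (k ≡ 2 ⊎ k ≡ 3) → UndirectedIndexIs (xPow k) 3)
         × ((k : ℕ) → 4 ≤ k → UndirectedIndexIs (xPow k) 2)
theorem7 = ternary , binary
  where
  ternary : (k : ℕ) → (k ≡ 2 ⊎ k ≡ 3) → UndirectedIndexIs (xPow k) 3
  ternary _ (inj₁ refl) =
    xPow-index≡3 2 ternaryThueMorse (ternaryThueMorse-avoids 0) binary-encounters-xPow2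
  ternary _ (inj₂ refl) =
    xPow-index≡3 3 ternaryThueMorse (ternaryThueMorse-avoids 1) binary-encounters-xPow3

  binary : (k : ℕ) → 4 ≤ k → UndirectedIndexIs (xPow k) 2
  binary (suc (suc (suc (suc K)))) _ = xPow-index≡2 (4 + K) periodDoublingWord (periodDoublingWord-avoids K)
  binary 0 ()
  binary 1 (s≤s ())
  binary 2 (s≤s (s≤s ()))
  binary 3 (s≤s (s≤s (s≤s ())))
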